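{- Let $\mathbb{G}$ and $\mathbb{H}$ be finite loopless graphs, let $e=\{a,a'\}$ be a critical edge of $\mathbb{G}$ and $f=\{b,b'\}$ a critical edge of $\mathbb{H}$, where $\mathbb{G}$ and $\mathbb{H}$ are not 3-colorable. Let $\mathbb{N}$ be a finite graph with four distinct vertices $x,x',y,y'$ such that $x,x'$ are non-adjacent and $y,y'$ are non-adjacent, and with a distinguished edge $d$, such that: (i) every homomorphism $c:\mathbb{N}\to\mathbb{K}_3$ satisfies exactly one of $c(x)\neq c(x')$, $c(y)\neq c(y')$; (ii) every map $c:\{x,x',y,y'\}\to V(\mathbb{K}_3)$ satisfying exactly one of these two inequalities extends to a homomorphism $\mathbb{N}\to\mathbb{K}_3$; (iii) every map $c:\{x,x',y,y'\}\to V(\mathbb{K}_3)$ with $c(x)=c(x')$ and $c(y)=c(y')$ extends to a homomorphism $\mathbb{N}-d\to\mathbb{K}_3$. Let $\mathbb{W}$ be the graph obtained from the disjoint union of $\mathbb{G}-e$, $\mathbb{N}$ and $\mathbb{H}-f$ by identifying $a$ with $x$, $a'$ with $x'$, $b$ with $y$, and $b'$ with $y'$. Then: (1) $\mathbb{W}$ is not 3-colorable; (2) $d$ is a critical edge of $\mathbb{W}$; (3) $\Sigma_{\mathbb{W}}$ is implied by both $\Sigma_{\mathbb{G}}$ and $\Sigma_{\mathbb{H}}$.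
   Context: Graphs are undirected ($E$ symmetric); 3-colorable means admitting a homomorphism to $\mathbb{K}_3$, the complete loopless graph on three vertices. For a graph $\mathbb{M}$ and an edge $e$, $\mathbb{M}-e$ is $\mathbb{M}$ with $e$ removed; $e$ is critical if $\mathbb{M}-e$ is 3-colorable. For a finite graph $\mathbb{G}=(V,E)$, $\Sigma_{\mathbb{G}}$ is the height 1 condition with a ternary symbol $f_v$ per $v\in V$, a 6-ary symbol $g_{(u,v)}$ per $(u,v)\in E$, and identities $f_u(x,y,z)\approx g_{(u,v)}(x,y,x,z,y,z)$, $f_v(x,y,z)\approx g_{(u,v)}(y,x,z,x,z,y)$ for all $(u,v)\in E$. A clone satisfies it if the symbols can be interpreted by clone functions of matching arities making all identities true; $\Sigma$ implies $\Sigma'$ if every clone satisfying $\Sigma$ satisfies $\Sigma'$. -}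

module Defs where

open import Level using (Level; _⊔_) renaming (suc to lsuc)
open import Data.Nat using (ℕ; zero; suc)
open import Data.Fin using (Fin; zero; suc; _≟_)
open import Data.Bool using (Bool; true; false; _∧_; _∨_; not; T)
open import Data.Bool.Properties using (∨-comm; T-irrelevant)
open import Data.Sum using (_⊎_; inj₁; inj₂)
import Data.Sum.Properties as SumP
open import Data.Product using (Σ; Σ-syntax; ∃; _×_; _,_; proj₁)
open import Data.Unit using (tt)
open import Data.Empty using (⊥-elim)
open import Data.Vec.Functional using ([]; _∷_)
open import Relation.Nullary using (¬_; yes; no; Dec)
open import Relation.Nullary.Decidable using (⌊_⌋)
open import Relation.Binary.Definitions using (DecidableEquality)
open import Relation.Binary.PropositionalEquality using (_≡_; _≢_; refl; cong; cong₂)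

-- Graphs: vertex set V, Boolean (hence proof-irrelevant) edge relation,
-- required to be symmetric (undirected graphs).

record Graph (V : Set) : Set where
  field
    E   : V → V → Bool
    sym : ∀ u v → E u v ≡ E v u
open Graph public

Loopless : ∀ {V} → Graph V → Set
Loopless {V} M = ∀ (v : V) → E M v v ≡ false

K₃ : Graph (Fin 3)
K₃ = record { E = λ i j → not ⌊ i ≟ j ⌋ ; sym = λ i j → cong not (lem i j) }
  where
  lem : ∀ (i j : Fin 3) → ⌊ i ≟ j ⌋ ≡ ⌊ j ≟ i ⌋
  lem i j with i ≟ j | j ≟ i
  ... | yes _ | yes _ = refl
  ... | no _  | no _  = refl
  ... | yes p | no q  = ⊥-elim (q (Relation.Binary.PropositionalEquality.sym p))
  ... | no p  | yes q = ⊥-elim (p (Relation.Binary.PropositionalEquality.sym q))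

Hom : ∀ {V W} → Graph V → Graph W → Set
Hom {V} {W} M K = Σ[ h ∈ (V → W) ] (∀ u v → T (E M u v) → T (E K (h u) (h v)))

ThreeColorable : ∀ {V} → Graph V → Set
ThreeColorable M = Hom M K₃

private
  swapLem : ∀ p q r s → (p ∧ q) ∨ (r ∧ s) ≡ (s ∧ r) ∨ (q ∧ p)
  swapLem true true true true = refl
  swapLem true true true false = refl
  swapLem true true false true = refl
  swapLem true true false false = refl
  swapLem true false true true = refl
  swapLem true false true false = refl
  swapLem true false false true = refl
  swapLem true false false false = refl
  swapLem false true true true = refl
  swapLem false true true false = refl
  swapLem false true false true = refl
  swapLem false true false false = refl
  swapLem false false true true = refl
  swapLem false false true false = refl
  swapLem false false false true = refl
  swapLem false false false false = refl

removeEdge : ∀ {V} → DecidableEquality V → Graph V → V → V → Graph V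
removeEdge {V} _≟V_ M u v = record { E = E′ ; sym = sym′ }
  where
  isE : V → V → Bool
  isE s t = (⌊ s ≟V u ⌋ ∧ ⌊ t ≟V v ⌋) ∨ (⌊ s ≟V v ⌋ ∧ ⌊ t ≟V u ⌋)
  E′ : V → V → Bool
  E′ s t = E M s t ∧ not (isE s t)
  sym′ : ∀ s t → E′ s t ≡ E′ t s
  sym′ s t = cong₂ _∧_ (sym M s t)
    (cong not (swapLem ⌊ s ≟V u ⌋ ⌊ t ≟V v ⌋ ⌊ s ≟V v ⌋ ⌊ t ≟V u ⌋))

Critical : ∀ {V} → DecidableEquality V → Graph V → V → V → Set
Critical dec M u v = T (E M u v) × ThreeColorable (removeEdge dec M u v)

ExactlyOne : Set → Set → Set
ExactlyOne P Q = (P × ¬ Q) ⊎ (¬ P × Q)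

Op : ∀ {ℓ} → Set ℓ → ℕ → Set ℓ
Op A n = (Fin n → A) → A

record Clone {ℓ} (A : Set ℓ) : Set (lsuc ℓ) where
  field
    Has  : ∀ {n} → Op A n → Set ℓ
    proj : ∀ n (i : Fin n) → Has (λ (xs : Fin n → A) → xs i)
    comp : ∀ {n m} (f : Op A n) (gs : Fin n → Op A m) →
           Has f → (∀ i → Has (gs i)) → Has (λ xs → f (λ i → gs i xs))
open Clone public

SatisfiesΣ : ∀ {ℓ} {V} {A : Set ℓ} → Clone A → Graph V → Set ℓ
SatisfiesΣ {V = V} {A} C M =
  Σ[ f ∈ (V → Op A 3) ]
  Σ[ g ∈ ((u v : V) → T (E M u v) → Op A 6) ]
    (∀ v → Has C (f v))
  × (∀ u v p → Has C (g u v p))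
  × (∀ u v p (x y z : A) →
        (f u (x ∷ y ∷ z ∷ []) ≡ g u v p (x ∷ y ∷ x ∷ z ∷ y ∷ z ∷ []))
      × (f v (x ∷ y ∷ z ∷ []) ≡ g u v p (y ∷ x ∷ z ∷ x ∷ z ∷ y ∷ [])))

Implies : ∀ ℓ {V V′} → Graph V → Graph V′ → Set (lsuc ℓ)
Implies ℓ M M′ = ∀ (A : Set ℓ) (C : Clone A) → SatisfiesΣ C M → SatisfiesΣ C M′

-- Vertex set of the result:
-- all of N, plus the vertices of G′ other than a, a′, plus those of H′ other than b, b′.

anyFin : ∀ {n} → (Fin n → Bool) → Bool
anyFin {zero}  f = false
anyFin {suc n} f = f zero ∨ anyFin (λ i → f (suc i))

private
  keep : ∀ {n} → Fin n → Fin n → Fin n → Bool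
  keep a a′ v = not ⌊ v ≟ a ⌋ ∧ not ⌊ v ≟ a′ ⌋

  keepProof : ∀ {n} {a a′ v : Fin n} → v ≢ a → v ≢ a′ → T (keep a a′ v)
  keepProof {a = a} {a′} {v} p q with v ≟ a | v ≟ a′
  ... | yes e | _     = ⊥-elim (p e)
  ... | no _  | yes e = ⊥-elim (q e)
  ... | no _  | no _  = tt

  Rest : ∀ {n} → Fin n → Fin n → Set
  Rest {n} a a′ = Σ (Fin n) (λ v → T (keep a a′ v))

  decRest : ∀ {n} (a a′ : Fin n) → DecidableEquality (Rest a a′)
  decRest a a′ (u , p) (v , q) with u ≟ v
  ... | no ne   = no (λ eq → ne (cong proj₁ eq))
  ... | yes refl = yes (cong (u ,_) (T-irrelevant p q))

module Glue {nG nN nH : ℕ}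
  (G′ : Graph (Fin nG)) (a a′ : Fin nG)
  (N : Graph (Fin nN)) (x x′ y y′ : Fin nN)
  (H′ : Graph (Fin nH)) (b b′ : Fin nH) where

  VW : Set
  VW = Fin nN ⊎ (Rest a a′ ⊎ Rest b b′)

  decW : DecidableEquality VW
  decW = SumP.≡-dec _≟_ (SumP.≡-dec (decRest a a′) (decRest b b′))

  ιN : Fin nN → VW
  ιN = inj₁

  ιG : Fin nG → VW
  ιG v with v ≟ a
  ... | yes _ = inj₁ x
  ... | no p with v ≟ a′
  ...   | yes _ = inj₁ x′
  ...   | no q  = inj₂ (inj₁ (v , keepProof p q))

  ιH : Fin nH → VW
  ιH v with v ≟ b
  ... | yes _ = inj₁ y
  ... | no p with v ≟ b′
  ...   | yes _ = inj₁ y′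
  ...   | no q  = inj₂ (inj₂ (v , keepProof p q))

  imgE : ∀ {k} → (Fin k → VW) → (Fin k → Fin k → Bool) → VW → VW → Bool
  imgE ι Ek w w′ = anyFin (λ u → anyFin (λ v →
                     Ek u v ∧ ⌊ decW (ι u) w ⌋ ∧ ⌊ decW (ι v) w′ ⌋))

  E₀ : VW → VW → Bool
  E₀ w w′ = imgE ιG (E G′) w w′ ∨ imgE ιN (E N) w w′ ∨ imgE ιH (E H′) w w′

  -- (E₀ is already symmetric since the components are; we symmetrize
  --  explicitly only to obtain the symmetry proof for free)
  W : Graph VW
  W = record { E = λ w w′ → E₀ w w′ ∨ E₀ w′ w
             ; sym = λ w w′ → ∨-comm (E₀ w w′) (E₀ w′ w) }

-- A 3-colouring of W restricts to a colouring of N, which by (i) separates x, x′ or y, y′;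
-- read on G − e (resp. H − f) it separates a, a′ (resp. b, b′) and so colours G (resp. H).
-- Conversely, colourings of G − e and H − f identify the ends of e and f, so (iii) glues
-- them along a colouring of N − d.  For (3), take a clone satisfying Σ_G, with f_v and
-- g = g_(a,a′).  The six arguments of g correspond to the six arcs of K₃, and (ii) gives six
-- colourings of N sending (x, x′) to these arcs and y, y′ to the common colour of b, b′ in a
-- fixed colouring of H − f.  Minors of g along the resulting colour vectors (constant ones
-- on H − f) interpret N and H − f, agreeing with f_a and f_a′ at x and x′; on G − e keep f.

module Submission where

open import Defs
open import Level using (Level)
open import Data.Nat using (ℕ; zero; suc)
open import Data.Fin using (Fin; zero; suc; _≟_)
open import Data.Fin.Patterns using (0F; 1F; 2F; 3F; 4F; 5F)
open import Data.Bool using (Bool; true; false; T; not; _∧_; _∨_)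
open import Data.Bool.Properties using (T-≡; T-∧; T-∨)
open import Data.Product using (Σ-syntax; ∃; ∃₂; _×_; _,_; proj₁; proj₂)
open import Data.Sum using (_⊎_; inj₁; inj₂; map)
open import Data.Unit using (tt)
open import Data.Empty using (⊥-elim)
open import Data.Vec.Functional using ([]; _∷_)
open import Function using (_∘_; flip; _⇔_; mk⇔; Equivalence)
open import Relation.Nullary using (¬_; yes; no; Dec)
open import Relation.Nullary.Decidable
  using (⌊_⌋; toWitness; fromWitness; toWitnessFalse; fromWitnessFalse; decidable-stable; _×-dec_; _⊎-dec_)
open import Relation.Binary.Definitions using (DecidableEquality; Reflexive)
open import Relation.Binary.PropositionalEquality using (_≡_; _≢_; refl; trans; cong; subst; subst₂)
import Relation.Binary.PropositionalEquality as ≡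

open Equivalence using (to; from)

T-not : ∀ {p} → T (not p) ⇔ (¬ T p)
T-not {false} = mk⇔ (λ _ ()) (λ _ → tt)
T-not {true}  = mk⇔ (λ ()) (λ ¬t → ¬t tt)

T-isYes-× : ∀ {p q} {P : Set p} {Q : Set q} (p? : Dec P) (q? : Dec Q) →
            T (⌊ p? ⌋ ∧ ⌊ q? ⌋) ⇔ (P × Q)
T-isYes-× p? q? = mk⇔
  (λ t → let s , t′ = to (T-∧ {⌊ p? ⌋}) t in toWitness s , toWitness t′)
  (λ (s , t) → from (T-∧ {⌊ p? ⌋}) (fromWitness s , fromWitness t))

T-anyFin : ∀ {n} {f : Fin n → Bool} → T (anyFin f) ⇔ ∃ (T ∘ f)
T-anyFin {zero}      = mk⇔ (λ ()) (λ { (() , _) })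
T-anyFin {suc n} {f} = mk⇔ to′ from′
  where
  to′ : T (anyFin f) → ∃ (T ∘ f)
  to′ t with to T-∨ t
  ... | inj₁ t₀ = zero , t₀
  ... | inj₂ ts with to T-anyFin ts
  ...   | i , tᵢ = suc i , tᵢ
  from′ : ∃ (T ∘ f) → T (anyFin f)
  from′ (zero  , t) = from T-∨ (inj₁ t)
  from′ (suc i , t) = from T-∨ (inj₂ (from T-anyFin (i , t)))

edge-sym : ∀ {V} (M : Graph V) {u v} → T (E M u v) → T (E M v u)
edge-sym M {u} {v} = subst T (sym M u v)

Loopless⇒≢ : ∀ {V} (M : Graph V) → Loopless M → ∀ {u v} → T (E M u v) → u ≢ v
Loopless⇒≢ M loopless {u} e refl = subst T (loopless u) e

Hom⇒ThreeColorable : ∀ {V₁ V₂} (M₁ : Graph V₁) (M₂ : Graph V₂) →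
                     Hom M₁ M₂ → ThreeColorable M₂ → ThreeColorable M₁
Hom⇒ThreeColorable M₁ M₂ (h , h-edge) (c , c-edge) =
  c ∘ h , λ u v e → c-edge (h u) (h v) (h-edge u v e)

K₃-edge : ∀ {i j : Fin 3} → T (E K₃ i j) ⇔ (i ≢ j)
K₃-edge = mk⇔ toWitnessFalse fromWitnessFalse

Joins : ∀ {V : Set} → V → V → V → V → Set
Joins p q u v = (u ≡ p × v ≡ q) ⊎ (u ≡ q × v ≡ p)

Joins-map : ∀ {V W : Set} (f : V → W) {p q u v} → Joins p q u v → Joins (f p) (f q) (f u) (f v)
Joins-map f (inj₁ (refl , refl)) = inj₁ (refl , refl)
Joins-map f (inj₂ (refl , refl)) = inj₂ (refl , refl)

module _ {V : Set} (dec : DecidableEquality V) where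

  T-removeEdge : ∀ (M : Graph V) p q {u v} →
                 T (E (removeEdge dec M p q) u v) ⇔ (T (E M u v) × ¬ Joins p q u v)
  T-removeEdge M p q {u} {v} = mk⇔
    (λ t → let e , t′ = to (T-∧ {E M u v}) t in e , to T-not t′ ∘ from T-joins)
    (λ (e , ¬j) → from (T-∧ {E M u v}) (e , from T-not (¬j ∘ to T-joins)))
    where
    T-joins : T ((⌊ dec u p ⌋ ∧ ⌊ dec v q ⌋) ∨ (⌊ dec u q ⌋ ∧ ⌊ dec v p ⌋)) ⇔ Joins p q u v
    T-joins = mk⇔
      (map (to (T-isYes-× (dec u p) (dec v q))) (to (T-isYes-× (dec u q) (dec v p)))
         ∘ to (T-∨ {⌊ dec u p ⌋ ∧ ⌊ dec v q ⌋}))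
      (from (T-∨ {⌊ dec u p ⌋ ∧ ⌊ dec v q ⌋})
         ∘ map (from (T-isYes-× (dec u p) (dec v q))) (from (T-isYes-× (dec u q) (dec v p))))

  removeEdge-⊆ : ∀ (M : Graph V) p q {u v} → T (E (removeEdge dec M p q) u v) → T (E M u v)
  removeEdge-⊆ M p q = proj₁ ∘ to (T-removeEdge M p q)

  extend-removeEdge : ∀ {W} {M : Graph V} {K : Graph W} {p q}
                      (c : Hom (removeEdge dec M p q) K) →
                      T (E K (proj₁ c p) (proj₁ c q)) → Hom M K
  extend-removeEdge {M = M} {K} {p} {q} (c , c-edge) cp~cq = c , edge
    where
    edge : ∀ u v → T (E M u v) → T (E K (c u) (c v))
    edge u v e with (dec u p ×-dec dec v q) ⊎-dec (dec u q ×-dec dec v p)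
    ... | yes (inj₁ (refl , refl)) = cp~cq
    ... | yes (inj₂ (refl , refl)) = edge-sym K cp~cq
    ... | no ¬j                    = c-edge u v (from (T-removeEdge M p q) (e , ¬j))

  uncolorable⇒ends-equal : ∀ (M : Graph V) p q → ¬ ThreeColorable M →
                           (c : Hom (removeEdge dec M p q) K₃) → proj₁ c p ≡ proj₁ c q
  uncolorable⇒ends-equal M p q ¬col c = decidable-stable (proj₁ c p ≟ proj₁ c q)
    (¬col ∘ extend-removeEdge {M = M} {K₃} c ∘ from K₃-edge)

-- Minors

-- Rebuilds a vector from its entries with _∷_; without function extensionality this is what
-- makes a minor along an explicit vector compute to the argument list written in Σ_M.
expand : ∀ {b} {B : Set b} {n} → (Fin n → B) → Fin n → B
expand {n = zero}  v = []
expand {n = suc n} v = v zero ∷ expand (v ∘ suc)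

expand-cong : ∀ {b} {B : Set b} {n} {u v : Fin n → B} → (∀ i → u i ≡ v i) → expand u ≡ expand v
expand-cong {n = zero}  e = refl
expand-cong {n = suc n} e = ≡.cong₂ _∷_ (e zero) (expand-cong (e ∘ suc))

expand-correct : ∀ {b} {B : Set b} {n} (v : Fin n → B) i → expand v i ≡ v i
expand-correct v zero    = refl
expand-correct v (suc i) = expand-correct (v ∘ suc) i

infix 4 _≈₃_
_≈₃_ : ∀ {ℓ} {A : Set ℓ} → Op A 3 → Op A 3 → Set ℓ
F ≈₃ F′ = ∀ x y z → F (x ∷ y ∷ z ∷ []) ≡ F′ (x ∷ y ∷ z ∷ [])

minor : ∀ {ℓ} {A : Set ℓ} {n k} → Op A n → (Fin n → Fin k) → Op A k
minor g σ xs = g (expand (xs ∘ σ))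

minor-cong : ∀ {ℓ} {A : Set ℓ} {n} (g : Op A n) {σ τ : Fin n → Fin 3} →
             (∀ i → σ i ≡ τ i) → minor g σ ≈₃ minor g τ
minor-cong g e x y z = cong g (expand-cong (cong (x ∷ y ∷ z ∷ []) ∘ e))

minor-∘ : ∀ {ℓ} {A : Set ℓ} {n m k} (g : Op A n) (ρ : Fin n → Fin m) (σ : Fin m → Fin k) →
          ∀ xs → minor (minor g ρ) σ xs ≡ minor g (σ ∘ ρ) xs
minor-∘ g ρ σ xs = cong g (expand-cong (expand-correct (xs ∘ σ) ∘ ρ))

-- The six arguments of g_(u,v) are indexed by the arcs of K₃: the identities of Σ_M read
-- f_u ≈ minor g src and f_v ≈ minor g tgt.
src tgt : Fin 6 → Fin 3
src = 0F ∷ 1F ∷ 0F ∷ 2F ∷ 1F ∷ 2F ∷ []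
tgt = 1F ∷ 0F ∷ 2F ∷ 0F ∷ 2F ∷ 1F ∷ []

src≢tgt : ∀ i → src i ≢ tgt i
src≢tgt 0F ()
src≢tgt 1F ()
src≢tgt 2F ()
src≢tgt 3F ()
src≢tgt 4F ()
src≢tgt 5F ()

arc : Fin 3 → Fin 3 → Fin 6
arc 0F 1F = 0F
arc 1F 0F = 1F
arc 0F 2F = 2F
arc 2F 0F = 3F
arc 1F 2F = 4F
arc 2F 1F = 5F
arc _  _  = 0F

src-tgt-arc : ∀ {s t} → s ≢ t → src (arc s t) ≡ s × tgt (arc s t) ≡ t
src-tgt-arc {0F} {0F} s≢t = ⊥-elim (s≢t refl)
src-tgt-arc {0F} {1F} _   = refl , refl
src-tgt-arc {0F} {2F} _   = refl , refl
src-tgt-arc {1F} {0F} _   = refl , refl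
src-tgt-arc {1F} {1F} s≢t = ⊥-elim (s≢t refl)
src-tgt-arc {1F} {2F} _   = refl , refl
src-tgt-arc {2F} {0F} _   = refl , refl
src-tgt-arc {2F} {1F} _   = refl , refl
src-tgt-arc {2F} {2F} s≢t = ⊥-elim (s≢t refl)

-- Interpretations of Σ_M in a clone

module _ {ℓ} {A : Set ℓ} (C : Clone A) where

  Has-minor : ∀ {n k} {g : Op A n} → Has C g → (σ : Fin n → Fin k) → Has C (minor g σ)
  Has-minor {k = k} {g} has-g σ = comp C g (λ i xs → expand (xs ∘ σ) i) has-g (Has-entry σ)
    where
    Has-entry : ∀ {n} (ρ : Fin n → Fin k) i → Has C (λ xs → expand (xs ∘ ρ) i)
    Has-entry ρ zero    = proj C k (ρ zero)
    Has-entry ρ (suc i) = Has-entry (ρ ∘ suc) i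

  record Adjacent (F F′ : Op A 3) : Set ℓ where
    constructor adjacent
    field
      witness     : Op A 6
      witness-Has : Has C witness
      ≈-src       : F ≈₃ minor witness src
      ≈-tgt       : F′ ≈₃ minor witness tgt

  Adjacent-resp : ∀ {F F′ F₁ F₁′} → F ≈₃ F₁ → F′ ≈₃ F₁′ → Adjacent F₁ F₁′ → Adjacent F F′
  Adjacent-resp F≈ F′≈ (adjacent g has-g F₁≈ F₁′≈) =
    adjacent g has-g (λ x y z → trans (F≈ x y z) (F₁≈ x y z))
                     (λ x y z → trans (F′≈ x y z) (F₁′≈ x y z))

  minor-adjacent : ∀ {g : Op A 6} → Has C g → (σ τ : Fin 6 → Fin 3) →
                   (∀ i → σ i ≢ τ i) → Adjacent (minor g σ) (minor g τ)
  minor-adjacent {g} has-g σ τ σ≢τ =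
    adjacent (minor g ρ) (Has-minor has-g ρ) σ≈ τ≈
    where
    ρ : Fin 6 → Fin 6
    ρ i = arc (σ i) (τ i)
    arcs : ∀ i → src (ρ i) ≡ σ i × tgt (ρ i) ≡ τ i
    arcs i = src-tgt-arc (σ≢τ i)
    σ≈ : minor g σ ≈₃ minor (minor g ρ) src
    σ≈ x y z = trans (minor-cong g (≡.sym ∘ proj₁ ∘ arcs) x y z)
                     (≡.sym (minor-∘ g ρ src (x ∷ y ∷ z ∷ [])))
    τ≈ : minor g τ ≈₃ minor (minor g ρ) tgt
    τ≈ x y z = trans (minor-cong g (≡.sym ∘ proj₂ ∘ arcs) x y z)
                     (≡.sym (minor-∘ g ρ tgt (x ∷ y ∷ z ∷ [])))

  IsInterpretation : ∀ {V} → Graph V → (V → Op A 3) → Set ℓ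
  IsInterpretation M F = (∀ v → Has C (F v)) × (∀ {u v} → T (E M u v) → Adjacent (F u) (F v))

  IsInterpretation-⊆ : ∀ {V} (M M′ : Graph V) {F} → (∀ {u v} → T (E M′ u v) → T (E M u v)) →
                       IsInterpretation M F → IsInterpretation M′ F
  IsInterpretation-⊆ _ _ M′⊆M (has-F , adj) = has-F , adj ∘ M′⊆M

  SatisfiesΣ⇒IsInterpretation : ∀ {V} (M : Graph V) (Σ-M : SatisfiesΣ C M) →
                                IsInterpretation M (proj₁ Σ-M)
  SatisfiesΣ⇒IsInterpretation M (f , g , has-f , has-g , ids) =
    has-f , λ {u} {v} e → adjacent (g u v e) (has-g u v e)
                                   (λ x y z → proj₁ (ids u v e x y z)) (λ x y z → proj₂ (ids u v e x y z))

  IsInterpretation⇒SatisfiesΣ : ∀ {V} {M : Graph V} {F} → IsInterpretation M F → SatisfiesΣ C M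
  IsInterpretation⇒SatisfiesΣ {F = F} (has-F , adj) =
    F , (λ u v e → witness (adj e)) , has-F , (λ u v e → witness-Has (adj e))
      , λ u v e x y z → ≈-src (adj e) x y z , ≈-tgt (adj e) x y z
    where open Adjacent

  -- Six 3-colourings of M form a homomorphism M → K₃⁶, and K₃⁶ interprets Σ by minors of g.
  minor-interpretation : ∀ {n} (M : Graph (Fin n)) {g : Op A 6} → Has C g →
                         (cs : Fin 6 → Hom M K₃) →
                         IsInterpretation M (λ v → minor g (λ i → proj₁ (cs i) v))
  minor-interpretation M has-g cs =
      (λ v → Has-minor has-g (λ i → proj₁ (cs i) v))
    , λ {u} {v} e → minor-adjacent has-g _ _ (λ i → to K₃-edge (proj₂ (cs i) u v e))

-- The glued graph

module Gluing {nG nN nH : ℕ}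
  (G′ : Graph (Fin nG)) (a a′ : Fin nG)
  (N : Graph (Fin nN)) (x x′ y y′ : Fin nN)
  (H′ : Graph (Fin nH)) (b b′ : Fin nH) where

  open Glue G′ a a′ N x x′ y y′ H′ b b′

  T-imgE : ∀ {k} {ι : Fin k → VW} {Eₖ w w′} →
           T (imgE ι Eₖ w w′) ⇔ (∃₂ λ u v → T (Eₖ u v) × ι u ≡ w × ι v ≡ w′)
  T-imgE {k} {ι} {Eₖ} {w} {w′} = mk⇔ to′ from′
    where
    Hit : Fin k → Fin k → Bool
    Hit u v = Eₖ u v ∧ ⌊ decW (ι u) w ⌋ ∧ ⌊ decW (ι v) w′ ⌋
    to′ : T (imgE ι Eₖ w w′) → ∃₂ λ u v → T (Eₖ u v) × ι u ≡ w × ι v ≡ w′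
    to′ t with to (T-anyFin {f = λ u → anyFin (Hit u)}) t
    ... | u , t′ with to (T-anyFin {f = Hit u}) t′
    ... | v , t″ with to (T-∧ {Eₖ u v}) t″
    ... | e , t‴ = u , v , e , to (T-isYes-× (decW (ι u) w) (decW (ι v) w′)) t‴
    from′ : (∃₂ λ u v → T (Eₖ u v) × ι u ≡ w × ι v ≡ w′) → T (imgE ι Eₖ w w′)
    from′ (u , v , e , ends) =
      from (T-anyFin {f = λ u → anyFin (Hit u)}) (u , from (T-anyFin {f = Hit u}) (v ,
        from (T-∧ {Eₖ u v}) (e , from (T-isYes-× (decW (ι u) w) (decW (ι v) w′)) ends)))

  imgE-elim : ∀ {k r} (ι : Fin k → VW) (Eₖ : Fin k → Fin k → Bool) (R : VW → VW → Set r) →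
              (∀ {u v} → T (Eₖ u v) → R (ι u) (ι v)) → ∀ {w w′} → T (imgE ι Eₖ w w′) → R w w′
  imgE-elim ι Eₖ R hₖ {w} {w′} t with to (T-imgE {ι = ι} {Eₖ} {w} {w′}) t
  ... | _ , _ , e , refl , refl = hₖ e

  imgE-intro : ∀ {k} (ι : Fin k → VW) (Eₖ : Fin k → Fin k → Bool) {u v} →
               T (Eₖ u v) → T (imgE ι Eₖ (ι u) (ι v))
  imgE-intro ι Eₖ {u} {v} e = from (T-imgE {ι = ι} {Eₖ}) (u , v , e , refl , refl)

  E₀⊆W : ∀ {w w′} → T (E₀ w w′) → T (E W w w′)
  E₀⊆W {w} {w′} = from (T-∨ {E₀ w w′} {E₀ w′ w}) ∘ inj₁

  embedG : Hom G′ W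
  embedG = ιG , λ u v e → E₀⊆W (from (T-∨ {imgE ιG (E G′) (ιG u) (ιG v)})
    (inj₁ (imgE-intro ιG (E G′) e)))

  embedN : Hom N W
  embedN = ιN , λ u v e → E₀⊆W (from (T-∨ {imgE ιG (E G′) (ιN u) (ιN v)})
    (inj₂ (from (T-∨ {imgE ιN (E N) (ιN u) (ιN v)}) (inj₁ (imgE-intro ιN (E N) e)))))

  embedH : Hom H′ W
  embedH = ιH , λ u v e → E₀⊆W (from (T-∨ {imgE ιG (E G′) (ιH u) (ιH v)})
    (inj₂ (from (T-∨ {imgE ιN (E N) (ιH u) (ιH v)}) (inj₂ (imgE-intro ιH (E H′) e)))))

  module _ {r} (R : VW → VW → Set r)
    (hG : ∀ {u v} → T (E G′ u v) → R (ιG u) (ιG v))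
    (hN : ∀ {u v} → T (E N u v) → R (ιN u) (ιN v))
    (hH : ∀ {u v} → T (E H′ u v) → R (ιH u) (ιH v)) where

    E₀-elim : ∀ {w w′} → T (E₀ w w′) → R w w′
    E₀-elim {w} {w′} t with to (T-∨ {imgE ιG (E G′) w w′}) t
    ... | inj₁ tG = imgE-elim ιG (E G′) R hG tG
    ... | inj₂ t′ with to (T-∨ {imgE ιN (E N) w w′}) t′
    ...   | inj₁ tN = imgE-elim ιN (E N) R hN tN
    ...   | inj₂ tH = imgE-elim ιH (E H′) R hH tH

  W-edge-elim : ∀ {r} (R : VW → VW → Set r) →
                (∀ {u v} → T (E G′ u v) → R (ιG u) (ιG v)) →
                (∀ {u v} → T (E N u v) → R (ιN u) (ιN v)) →
                (∀ {u v} → T (E H′ u v) → R (ιH u) (ιH v)) →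
                ∀ {w w′} → T (E W w w′) → R w w′
  W-edge-elim R hG hN hH {w} {w′} t with to (T-∨ {E₀ w w′}) t
  ... | inj₁ t→ = E₀-elim R hG hN hH t→
  ... | inj₂ t← = E₀-elim (flip R) (hG ∘ edge-sym G′) (hN ∘ edge-sym N) (hH ∘ edge-sym H′) t←

  W-removeEdge-elim : ∀ {r d d′} (R : VW → VW → Set r) →
                      (∀ {u v} → T (E G′ u v) → R (ιG u) (ιG v)) →
                      (∀ {u v} → T (E (removeEdge _≟_ N d d′) u v) → R (ιN u) (ιN v)) →
                      (∀ {u v} → T (E H′ u v) → R (ιH u) (ιH v)) →
                      ∀ {w w′} → T (E (removeEdge decW W (ιN d) (ιN d′)) w w′) → R w w′
  W-removeEdge-elim {d = d} {d′} R hG hN hH t =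
    let e , ¬j = to (T-removeEdge decW W (ιN d) (ιN d′)) t in
    W-edge-elim (λ w w′ → ¬ Joins (ιN d) (ιN d′) w w′ → R w w′)
      (λ e _ → hG e)
      (λ e ¬j → hN (from (T-removeEdge _≟_ N d d′) (e , ¬j ∘ Joins-map ιN)))
      (λ e _ → hH e)
      e ¬j

  ιG-a : ιG a ≡ ιN x
  ιG-a with a ≟ a
  ... | yes _   = refl
  ... | no a≢a = ⊥-elim (a≢a refl)

  ιG-a′ : a ≢ a′ → ιG a′ ≡ ιN x′
  ιG-a′ a≢a′ with a′ ≟ a
  ... | yes a′≡a = ⊥-elim (a≢a′ (≡.sym a′≡a))
  ... | no _ with a′ ≟ a′
  ...   | yes _     = refl
  ...   | no a′≢a′ = ⊥-elim (a′≢a′ refl)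

  ιH-b : ιH b ≡ ιN y
  ιH-b with b ≟ b
  ... | yes _   = refl
  ... | no b≢b = ⊥-elim (b≢b refl)

  ιH-b′ : b ≢ b′ → ιH b′ ≡ ιN y′
  ιH-b′ b≢b′ with b′ ≟ b
  ... | yes b′≡b = ⊥-elim (b≢b′ (≡.sym b′≡b))
  ... | no _ with b′ ≟ b′
  ...   | yes _     = refl
  ...   | no b′≢b′ = ⊥-elim (b′≢b′ refl)

  paste : ∀ {c} {X : Set c} → (Fin nN → X) → (Fin nG → X) → (Fin nH → X) → VW → X
  paste φN φG φH (inj₁ n)             = φN n
  paste φN φG φH (inj₂ (inj₁ (v , _))) = φG v
  paste φN φG φH (inj₂ (inj₂ (v , _))) = φH v

  module _ {c r} {X : Set c} (_∼_ : X → X → Set r) (∼-refl : Reflexive _∼_)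
    (φN : Fin nN → X) (φG : Fin nG → X) (φH : Fin nH → X) where

    paste-ιG : φN x ∼ φG a → φN x′ ∼ φG a′ → ∀ u → paste φN φG φH (ιG u) ∼ φG u
    paste-ιG x∼a x′∼a′ u with u ≟ a
    ... | yes refl = x∼a
    ... | no _ with u ≟ a′
    ...   | yes refl = x′∼a′
    ...   | no _     = ∼-refl

    paste-ιH : φN y ∼ φH b → φN y′ ∼ φH b′ → ∀ u → paste φN φG φH (ιH u) ∼ φH u
    paste-ιH y∼b y′∼b′ u with u ≟ b
    ... | yes refl = y∼b
    ... | no _ with u ≟ b′
    ...   | yes refl = y′∼b′
    ...   | no _     = ∼-refl

  paste-Hom : ∀ {d d′} (cG : Hom G′ K₃) (cN : Hom (removeEdge _≟_ N d d′) K₃) (cH : Hom H′ K₃) →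
              let φN = proj₁ cN ; φG = proj₁ cG ; φH = proj₁ cH in
              φN x ≡ φG a → φN x′ ≡ φG a′ → φN y ≡ φH b → φN y′ ≡ φH b′ →
              Hom (removeEdge decW W (ιN d) (ιN d′)) K₃
  paste-Hom (φG , G-edge) (φN , N-edge) (φH , H-edge) x≡a x′≡a′ y≡b y′≡b′ =
    φ , λ w w′ → W-removeEdge-elim (λ w w′ → T (E K₃ (φ w) (φ w′)))
      (λ {u} {v} e → subst₂ (λ s t → T (E K₃ s t)) (≡.sym (onG u)) (≡.sym (onG v)) (G-edge u v e))
      (λ {u} {v} e → N-edge u v e)
      (λ {u} {v} e → subst₂ (λ s t → T (E K₃ s t)) (≡.sym (onH u)) (≡.sym (onH v)) (H-edge u v e))
    where
    φ = paste φN φG φH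
    onG = paste-ιG _≡_ refl φN φG φH x≡a x′≡a′
    onH = paste-ιH _≡_ refl φN φG φH y≡b y′≡b′

  paste-interpretation : ∀ {ℓ} {A : Set ℓ} (C : Clone A) {φN φG φH} →
                         IsInterpretation C G′ φG → IsInterpretation C N φN → IsInterpretation C H′ φH →
                         φN x ≈₃ φG a → φN x′ ≈₃ φG a′ → φN y ≈₃ φH b → φN y′ ≈₃ φH b′ →
                         IsInterpretation C W (paste φN φG φH)
  paste-interpretation C {φN} {φG} {φH} (has-G , adj-G) (has-N , adj-N) (has-H , adj-H)
                       x≈a x′≈a′ y≈b y′≈b′ =
    has , W-edge-elim (λ w w′ → Adjacent C (paste φN φG φH w) (paste φN φG φH w′))
      (λ {u} {v} e → Adjacent-resp C (onG u) (onG v) (adj-G e))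
      adj-N
      (λ {u} {v} e → Adjacent-resp C (onH u) (onH v) (adj-H e))
    where
    onG = paste-ιG _≈₃_ (λ _ _ _ → refl) φN φG φH x≈a x′≈a′
    onH = paste-ιH _≈₃_ (λ _ _ _ → refl) φN φG φH y≈b y′≈b′
    has : ∀ w → Has C (paste φN φG φH w)
    has (inj₁ n)             = has-N n
    has (inj₂ (inj₁ (v , _))) = has-G v
    has (inj₂ (inj₂ (v , _))) = has-H v

module Construction {nG nN nH : ℕ}
  (G : Graph (Fin nG)) (a a′ : Fin nG)
  (N : Graph (Fin nN)) (x x′ y y′ : Fin nN)
  (H : Graph (Fin nH)) (b b′ : Fin nH) where

  G′ : Graph (Fin nG)
  G′ = removeEdge _≟_ G a a′

  H′ : Graph (Fin nH)
  H′ = removeEdge _≟_ H b b′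

  open Glue G′ a a′ N x x′ y y′ H′ b b′
  open Gluing G′ a a′ N x x′ y y′ H′ b b′

  ColorsTerminals : (Fin nN → Fin 3) → Fin 3 → Fin 3 → Fin 3 → Fin 3 → Set
  ColorsTerminals c cx cx′ cy cy′ = (c x ≡ cx) × (c x′ ≡ cx′) × (c y ≡ cy) × (c y′ ≡ cy′)

  W-uncolorable : a ≢ a′ → b ≢ b′ → ¬ ThreeColorable G → ¬ ThreeColorable H →
                  (∀ (c : Hom N K₃) → ExactlyOne (proj₁ c x ≢ proj₁ c x′) (proj₁ c y ≢ proj₁ c y′)) →
                  ¬ ThreeColorable W
  W-uncolorable a≢a′ b≢b′ ¬colG ¬colH split c with split (Hom⇒ThreeColorable N W embedN c)
  ... | inj₁ (x≁x′ , _) =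
    x≁x′ (subst₂ (λ s t → proj₁ c s ≡ proj₁ c t) ιG-a (ιG-a′ a≢a′)
           (uncolorable⇒ends-equal _≟_ G a a′ ¬colG (Hom⇒ThreeColorable G′ W embedG c)))
  ... | inj₂ (_ , y≁y′) =
    y≁y′ (subst₂ (λ s t → proj₁ c s ≡ proj₁ c t) ιH-b (ιH-b′ b≢b′)
           (uncolorable⇒ends-equal _≟_ H b b′ ¬colH (Hom⇒ThreeColorable H′ W embedH c)))

  W-critical : ∀ {d d′} (cG : Hom G′ K₃) (cH : Hom H′ K₃) →
               proj₁ cG a ≡ proj₁ cG a′ → proj₁ cH b ≡ proj₁ cH b′ → E N d d′ ≡ true →
               (∀ cx cx′ cy cy′ → cx ≡ cx′ → cy ≡ cy′ →
                 Σ[ c ∈ Hom (removeEdge _≟_ N d d′) K₃ ] ColorsTerminals (proj₁ c) cx cx′ cy cy′) →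
               Critical decW W (ιN d) (ιN d′)
  W-critical {d} {d′} cG cH a≡a′ b≡b′ Ndd′ extend with extend _ _ _ _ a≡a′ b≡b′
  ... | cN , x↦ , x′↦ , y↦ , y′↦ = proj₂ embedN d d′ (from T-≡ Ndd′) , paste-Hom cG cN cH x↦ x′↦ y↦ y′↦

  module _ (extend : ∀ cx cx′ cy cy′ → ExactlyOne (cx ≢ cx′) (cy ≢ cy′) →
                     Σ[ c ∈ Hom N K₃ ] ColorsTerminals (proj₁ c) cx cx′ cy cy′) where

    W-implied-by-G : ∀ ℓ → T (E G a a′) → (cH : Hom H′ K₃) → proj₁ cH b ≡ proj₁ cH b′ →
                     Implies ℓ G W
    W-implied-by-G ℓ Gaa′ cH b≡b′ A C Σ-G =
      IsInterpretation⇒SatisfiesΣ C {M = W} (paste-interpretation C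
        (IsInterpretation-⊆ C G G′ (removeEdge-⊆ _≟_ G a a′) interpret-G)
        (minor-interpretation C N has-g cs)
        (minor-interpretation C H′ has-g (λ _ → cH))
        (λ p q r → trans (minor-cong g x↦src p q r) (≡.sym (fa≈ p q r)))
        (λ p q r → trans (minor-cong g x′↦tgt p q r) (≡.sym (fa′≈ p q r)))
        (minor-cong g y↦b)
        (minor-cong g y′↦b′))
      where
      interpret-G : IsInterpretation C G (proj₁ Σ-G)
      interpret-G = SatisfiesΣ⇒IsInterpretation C G Σ-G
      open Adjacent (proj₂ interpret-G Gaa′)
        renaming (witness to g; witness-Has to has-g; ≈-src to fa≈; ≈-tgt to fa′≈)
      coloring : ∀ i → Σ[ c ∈ Hom N K₃ ]
                       ColorsTerminals (proj₁ c) (src i) (tgt i) (proj₁ cH b) (proj₁ cH b′)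
      coloring i = extend _ _ _ _ (inj₁ (src≢tgt i , λ ne → ne b≡b′))
      cs : Fin 6 → Hom N K₃
      cs = proj₁ ∘ coloring
      x↦src : ∀ i → proj₁ (cs i) x ≡ src i
      x↦src = proj₁ ∘ proj₂ ∘ coloring
      x′↦tgt : ∀ i → proj₁ (cs i) x′ ≡ tgt i
      x′↦tgt = proj₁ ∘ proj₂ ∘ proj₂ ∘ coloring
      y↦b : ∀ i → proj₁ (cs i) y ≡ proj₁ cH b
      y↦b = proj₁ ∘ proj₂ ∘ proj₂ ∘ proj₂ ∘ coloring
      y′↦b′ : ∀ i → proj₁ (cs i) y′ ≡ proj₁ cH b′
      y′↦b′ = proj₂ ∘ proj₂ ∘ proj₂ ∘ proj₂ ∘ coloring

    W-implied-by-H : ∀ ℓ → T (E H b b′) → (cG : Hom G′ K₃) → proj₁ cG a ≡ proj₁ cG a′ →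
                     Implies ℓ H W
    W-implied-by-H ℓ Hbb′ cG a≡a′ A C Σ-H =
      IsInterpretation⇒SatisfiesΣ C {M = W} (paste-interpretation C
        (minor-interpretation C G′ has-g (λ _ → cG))
        (minor-interpretation C N has-g cs)
        (IsInterpretation-⊆ C H H′ (removeEdge-⊆ _≟_ H b b′) interpret-H)
        (minor-cong g x↦a)
        (minor-cong g x′↦a′)
        (λ p q r → trans (minor-cong g y↦src p q r) (≡.sym (fb≈ p q r)))
        (λ p q r → trans (minor-cong g y′↦tgt p q r) (≡.sym (fb′≈ p q r))))
      where
      interpret-H : IsInterpretation C H (proj₁ Σ-H)
      interpret-H = SatisfiesΣ⇒IsInterpretation C H Σ-H
      open Adjacent (proj₂ interpret-H Hbb′)
        renaming (witness to g; witness-Has to has-g; ≈-src to fb≈; ≈-tgt to fb′≈)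
      coloring : ∀ i → Σ[ c ∈ Hom N K₃ ]
                       ColorsTerminals (proj₁ c) (proj₁ cG a) (proj₁ cG a′) (src i) (tgt i)
      coloring i = extend _ _ _ _ (inj₂ ((λ ne → ne a≡a′) , src≢tgt i))
      cs : Fin 6 → Hom N K₃
      cs = proj₁ ∘ coloring
      x↦a : ∀ i → proj₁ (cs i) x ≡ proj₁ cG a
      x↦a = proj₁ ∘ proj₂ ∘ coloring
      x′↦a′ : ∀ i → proj₁ (cs i) x′ ≡ proj₁ cG a′
      x′↦a′ = proj₁ ∘ proj₂ ∘ proj₂ ∘ coloring
      y↦src : ∀ i → proj₁ (cs i) y ≡ src i
      y↦src = proj₁ ∘ proj₂ ∘ proj₂ ∘ proj₂ ∘ coloring
      y′↦tgt : ∀ i → proj₁ (cs i) y′ ≡ tgt i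
      y′↦tgt = proj₂ ∘ proj₂ ∘ proj₂ ∘ proj₂ ∘ coloring

lemmaA1 : ∀ {ℓ : Level} {nG nH nN : ℕ}
    (G : Graph (Fin nG)) (H : Graph (Fin nH)) (N : Graph (Fin nN))
    (a a′ : Fin nG) (b b′ : Fin nH) (x x′ y y′ : Fin nN) (d d′ : Fin nN) →
    Loopless G → Loopless H →
    Critical _≟_ G a a′ → Critical _≟_ H b b′ →
    ¬ ThreeColorable G → ¬ ThreeColorable H →
    x ≢ x′ → x ≢ y → x ≢ y′ → x′ ≢ y → x′ ≢ y′ → y ≢ y′ →
    E N x x′ ≡ false → E N y y′ ≡ false →
    E N d d′ ≡ true →
    (∀ (c : Hom N K₃) → ExactlyOne (proj₁ c x ≢ proj₁ c x′) (proj₁ c y ≢ proj₁ c y′)) →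
    (∀ (cx cx′ cy cy′ : Fin 3) → ExactlyOne (cx ≢ cx′) (cy ≢ cy′) →
      Σ[ c ∈ Hom N K₃ ] ((proj₁ c x ≡ cx) × (proj₁ c x′ ≡ cx′) × (proj₁ c y ≡ cy) × (proj₁ c y′ ≡ cy′))) →
    (∀ (cx cx′ cy cy′ : Fin 3) → cx ≡ cx′ → cy ≡ cy′ →
      Σ[ c ∈ Hom (removeEdge _≟_ N d d′) K₃ ]
        ((proj₁ c x ≡ cx) × (proj₁ c x′ ≡ cx′) × (proj₁ c y ≡ cy) × (proj₁ c y′ ≡ cy′))) →
    (¬ ThreeColorable (Glue.W (removeEdge _≟_ G a a′) a a′ N x x′ y y′ (removeEdge _≟_ H b b′) b b′))
    × Critical (Glue.decW (removeEdge _≟_ G a a′) a a′ N x x′ y y′ (removeEdge _≟_ H b b′) b b′)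
        (Glue.W (removeEdge _≟_ G a a′) a a′ N x x′ y y′ (removeEdge _≟_ H b b′) b b′)
        (Glue.ιN (removeEdge _≟_ G a a′) a a′ N x x′ y y′ (removeEdge _≟_ H b b′) b b′ d)
        (Glue.ιN (removeEdge _≟_ G a a′) a a′ N x x′ y y′ (removeEdge _≟_ H b b′) b b′ d′)
    × Implies ℓ G (Glue.W (removeEdge _≟_ G a a′) a a′ N x x′ y y′ (removeEdge _≟_ H b b′) b b′)
    × Implies ℓ H (Glue.W (removeEdge _≟_ G a a′) a a′ N x x′ y y′ (removeEdge _≟_ H b b′) b b′)
lemmaA1 {ℓ} G H N a a′ b b′ x x′ y y′ d d′ loopless-G loopless-H (Gaa′ , cG) (Hbb′ , cH)
        ¬colG ¬colH _ _ _ _ _ _ _ _ Ndd′ split extend extend∖d =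
    W-uncolorable (Loopless⇒≢ G loopless-G Gaa′) (Loopless⇒≢ H loopless-H Hbb′) ¬colG ¬colH split
  , W-critical cG cH a≡a′ b≡b′ Ndd′ extend∖d
  , W-implied-by-G extend ℓ Gaa′ cH b≡b′
  , W-implied-by-H extend ℓ Hbb′ cG a≡a′
  where
  open Construction G a a′ N x x′ y y′ H b b′
  a≡a′ = uncolorable⇒ends-equal _≟_ G a a′ ¬colG cG
  b≡b′ = uncolorable⇒ends-equal _≟_ H b b′ ¬colH cH
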